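{- Let $M\in\Lambda^{001}_\infty$. Then $M\to_{\beta\bot}^\infty\mathrm{BT}(M)$. Furthermore, if $\mathrm{BT}(M)\in\Lambda^{001}_\infty$ (i.e. it contains no $\bot$), then $M\to_\beta^\infty\mathrm{BT}(M)$.
   Context: Fix an infinite set $\mathcal V$ of variables. $\Lambda^{001}_{\bot\infty}=\nu Y.\mu X.(\mathcal V+\lambda\mathcal V.X+(X)Y+\bot)$ is the set of possibly infinite syntax trees built from variables, abstractions $\lambda x.M$, applications $(M)N$ and a constant $\bot$, in which every infinite branch passes infinitely often through the argument (right) subterm of an application; $\Lambda^{001}_\infty$ is the subset of terms without $\bot$. Terms are up to α-equivalence. $\to_\beta$ is one-step β-reduction (contextual closure of $(\lambda x.M)N\mapsto M[N/x]$). For a one-step relation $\to$, its 001-strongly convergent closure $\to^\infty$ is: $M\to^\infty a$ if $M\to^*a$ with $a$ a variable or $\bot$; $M\to^\infty\lambda x.P'$ if $M\to^*\lambda x.P$ and $P\to^\infty P'$; $M\to^\infty(P')Q'$ if $M\to^*(P)Q$, $P\to^\infty P'$, $Q\to^\infty Q'$; derivations may be infinite but every infinite branch passes infinitely often through the premise $Q\to^\infty Q'$. $\to_\beta^\infty$ is this closure for $\to_\beta$. $M\in\Lambda^{001}_\infty$ is solvable if there are variables $x_1,\dots,x_m$ and $N_1,\dots,N_n\in\Lambda^{001}_\infty$ with $(\dots((\lambda x_1\dots\lambda x_m.M)N_1)\dots)N_n\to_\beta^\infty\lambda x.x$, unsolvable otherwise. $\to_{\beta\bot}$ is the contextual closure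 of $\beta_0\cup\bot_0$ where $\beta_0=\{((\lambda x.M)N,M[N/x])\}$ and $\bot_0=\{(M,\bot)\mid M\text{ unsolvable}\}\cup\{(\lambda x.\bot,\bot)\}\cup\{((\bot)M,\bot)\}$; $\to_{\beta\bot}^\infty$ is its 001-strongly convergent closure. Head normal forms are terms $\lambda x_1\dots\lambda x_m.(\dots((y)Q_1)\dots)Q_n$; otherwise a term is $\lambda x_1\dots\lambda x_m.(\dots(((\lambda z.N)P)Q_1)\dots)Q_n$ and head reduction $\to_h$ fires $(\lambda z.N)P$. The Böhm tree $\mathrm{BT}(M)\in\Lambda^{001}_{\bot\infty}$ is defined corecursively: $\mathrm{BT}(M)=\bot$ if $M$ is unsolvable; if $M$ is solvable and $M\to_h^*\lambda x_1\dots\lambda x_m.(\dots((y)M_1)\dots)M_n$ then $\mathrm{BT}(M)=\lambda x_1\dots\lambda x_m.(\dots((y)\mathrm{BT}(M_1))\dots)\mathrm{BT}(M_n)$. -}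

module Defs where

-- Only positions reachable from the root (`Valid`) matter;
-- labels at other positions are junk, and terms are compared with `_≈_`
-- (agreement on all valid positions).  Binders use de Bruijn indices, so
-- α-equivalent terms have the same representation; the variable set V is
-- ℕ, a free variable named x being the index x at top level.

open import Data.Nat using (ℕ; zero; suc; _≡ᵇ_)
open import Data.Bool using (if_then_else_)
open import Data.List using (List; []; _∷_; _++_; [_]; length; replicate)
open import Data.List.Relation.Unary.All using (All)
open import Data.Product using (Σ; _×_)
open import Data.Sum using (_⊎_)
open import Data.Unit using (⊤)
open import Data.Empty using (⊥)
open import Relation.Nullary using (¬_)
open import Relation.Binary.PropositionalEquality using (_≡_; _≢_)
open import Relation.Binary.Construct.Closure.ReflexiveTransitive using (Star)

data Dir : Set where
  L R : Dir   -- L : body of λ / function part of an application; R : argument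

data Lab : Set where
  var : ℕ → Lab
  lam : Lab
  app : Lab
  bot : Lab

Pos : Set
Pos = List Dir

Tree : Set
Tree = Pos → Lab

down : Dir → Tree → Tree
down d T q = T (d ∷ q)

at : Tree → Pos → Tree
at T [] = T
at T (d ∷ p) = at (down d T) p

HasL : Lab → Set
HasL lam = ⊤
HasL app = ⊤
HasL (var _) = ⊥
HasL bot = ⊥

data Valid (T : Tree) : Pos → Set where
  here : Valid T []
  goL  : ∀ {p} → HasL (T []) → Valid (down L T) p → Valid T (L ∷ p)
  goR  : ∀ {p} → T [] ≡ app → Valid (down R T) p → Valid T (R ∷ p)

_≈_ : Tree → Tree → Set
T ≈ U = ∀ p → Valid T p → T p ≡ U p

-- 001 condition: from every reachable node, the path of L-moves is finite
-- (i.e. no infinite branch eventually avoids argument positions)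
data LeftFin (T : Tree) : Set where
  stop : ¬ HasL (T []) → LeftFin T
  step : HasL (T []) → LeftFin (down L T) → LeftFin T

Is001 : Tree → Set
Is001 T = ∀ p → Valid T p → LeftFin (at T p)

-- Λ^{001}_{⊥∞} ∋ T  is  Is001 T ;  Λ^{001}_∞ ∋ T  is  Is001 T × NoBot T
NoBot : Tree → Set
NoBot T = ∀ p → Valid T p → T p ≢ bot

vT : ℕ → Tree
vT x _ = var x

botT : Tree
botT _ = bot

lamT : Tree → Tree
lamT M [] = lam
lamT M (L ∷ p) = M p
lamT M (R ∷ p) = bot

appT : Tree → Tree → Tree
appT M N [] = app
appT M N (L ∷ p) = M p
appT M N (R ∷ p) = N p

idT : Tree
idT = lamT (vT 0)

ext : (ℕ → ℕ) → ℕ → ℕ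
ext ρ zero = zero
ext ρ (suc i) = suc (ρ i)

ren : (ℕ → ℕ) → Tree → Tree
ren ρ T p with T []
ren ρ T [] | var i = var (ρ i)
ren ρ T [] | l = l
ren ρ T (L ∷ p) | lam = ren (ext ρ) (down L T) p
ren ρ T (L ∷ p) | _ = ren ρ (down L T) p
ren ρ T (R ∷ p) | _ = ren ρ (down R T) p

exts : (ℕ → Tree) → ℕ → Tree
exts σ zero = vT zero
exts σ (suc i) = ren suc (σ i)

sub : (ℕ → Tree) → Tree → Tree
sub σ T p with T []
sub σ T p | var i = σ i p
sub σ T [] | lam = lam
sub σ T (L ∷ p) | lam = sub (exts σ) (down L T) p
sub σ T (R ∷ p) | lam = bot
sub σ T [] | app = app
sub σ T (d ∷ p) | app = sub σ (down d T) p
sub σ T p | bot = bot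

-- M[N/x] where x is the de Bruijn variable 0
sub0 : Tree → Tree → Tree
sub0 N M = sub σ M
  where
  σ : ℕ → Tree
  σ zero = N
  σ (suc i) = vT i

-- named abstraction λx.M of the free variable x, and λx₁…λxₘ.M
absN : ℕ → Tree → Tree
absN x M = lamT (ren (λ i → if i ≡ᵇ x then 0 else suc i) M)

close : List ℕ → Tree → Tree
close [] M = M
close (x ∷ xs) M = absN x (close xs M)

applyAll : Tree → List Tree → Tree
applyAll M [] = M
applyAll M (N ∷ Ns) = applyAll (appT M N) Ns

Rel : Set₁
Rel = Tree → Tree → Set

data Ctx (S : Rel) : Rel where
  root : ∀ {M N} → S M N → Ctx S M N
  lamC : ∀ {M N} → M [] ≡ lam → N [] ≡ lam →
         Ctx S (down L M) (down L N) → Ctx S M N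
  appL : ∀ {M N} → M [] ≡ app → N [] ≡ app →
         Ctx S (down L M) (down L N) → down R M ≈ down R N → Ctx S M N
  appR : ∀ {M N} → M [] ≡ app → N [] ≡ app →
         down L M ≈ down L N → Ctx S (down R M) (down R N) → Ctx S M N

-- A (possibly infinite) derivation of M →^∞ T is given by the term
-- `res p` that is rewritten at each reachable position p of T:
-- res [] is M, and res p →* X where X has the root label of T at p and
-- its children are (≈) the terms res at the children positions of p.
-- Branches of the derivation are branches of T, so the 001 condition on
-- derivations is the 001 condition on T.
record Inf (S : Rel) (M T : Tree) : Set where
  field
    target001 : Is001 T
    res       : Pos → Tree
    resRoot   : res [] ≡ M
    resStep   : ∀ p → Valid T p → Σ Tree λ X →
                Star S (res p) X × X [] ≡ T p ×
                (HasL (T p) → down L X ≈ res (p ++ [ L ])) ×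
                (T p ≡ app → down R X ≈ res (p ++ [ R ]))

data Beta₀ : Rel where
  beta : ∀ {M N} → M [] ≡ app → down L M [] ≡ lam →
         N ≈ sub0 (down R M) (down L (down L M)) → Beta₀ M N

_→β_ : Rel
_→β_ = Ctx Beta₀

_→β∞_ : Rel
_→β∞_ = Inf _→β_

Solvable : Tree → Set
Solvable M = Σ (List ℕ) λ xs → Σ (List Tree) λ Ns →
  All (λ N → Is001 N × NoBot N) Ns × (applyAll (close xs M) Ns →β∞ idT)

Unsolvable : Tree → Set
Unsolvable M = (Is001 M × NoBot M) × ¬ Solvable M

data BetaBot₀ : Rel where
  beta   : ∀ {M N} → Beta₀ M N → BetaBot₀ M N
  unsol  : ∀ {M N} → Unsolvable M → N [] ≡ bot → BetaBot₀ M N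
  lamBot : ∀ {M N} → M [] ≡ lam → down L M [] ≡ bot → N [] ≡ bot → BetaBot₀ M N
  appBot : ∀ {M N} → M [] ≡ app → down L M [] ≡ bot → N [] ≡ bot → BetaBot₀ M N

_→β⊥_ : Rel
_→β⊥_ = Ctx BetaBot₀

_→β⊥∞_ : Rel
_→β⊥∞_ = Inf _→β⊥_

data Head : Rel where
  hβ   : ∀ {M N} → Beta₀ M N → Head M N
  hlam : ∀ {M N} → M [] ≡ lam → N [] ≡ lam →
         Head (down L M) (down L N) → Head M N
  happ : ∀ {M N} → M [] ≡ app → down L M [] ≡ app → N [] ≡ app →
         Head (down L M) (down L N) → down R M ≈ down R N → Head M N

lams : ℕ → Tree → Tree
lams zero M = M
lams (suc m) M = lamT (lams m M)

-- (…((h)Q₁)…)Qₙ, the list being given as [Qₙ, …, Q₁]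
appsR : Tree → List Tree → Tree
appsR h [] = h
appsR h (q ∷ qs) = appT (appsR h qs) q

ArgsAt : (Pos → Tree) → Pos → List Tree → Set
ArgsAt G pre [] = ⊤
ArgsAt G pre (q ∷ qs) = G (pre ++ [ R ]) ≡ q × ArgsAt G (pre ++ [ L ]) qs

-- The corecursion is unfolded into an assignment `g` of a term to each
-- node of T (the root and every argument position): g [] is M, and at a
-- node q, either g q is unsolvable and T has ⊥ at q, or g q is solvable,
-- g q →h* λx₁…λxₘ.(…((y)Q₁)…)Qₙ, T at q is λx₁…λxₘ.(…((y)U₁)…)Uₙ and
-- g is Qᵢ at the position of Uᵢ.

data IsNode : Pos → Set where
  rootN : IsNode []
  argN  : ∀ p → IsNode (p ++ [ R ])

BTClause : Tree → Tree → (Pos → Tree) → Set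
BTClause N U G =
  (Unsolvable N × U [] ≡ bot) ⊎
  (Solvable N × Σ ℕ λ m → Σ ℕ λ y → Σ (List Tree) λ qs → Σ (List Tree) λ us →
     Star Head N (lams m (appsR (vT y) qs)) ×
     U ≈ lams m (appsR (vT y) us) ×
     length us ≡ length qs ×
     ArgsAt G (replicate m L) qs)

record IsBT (M T : Tree) : Set where
  field
    g     : Pos → Tree
    gRoot : g [] ≡ M
    node  : ∀ q → Valid T q → IsNode q →
            BTClause (g q) (at T q) (λ r → g (q ++ r))

{-# OPTIONS --safe #-}
module Submission where

-- The Böhm tree prescribes the whole infinite derivation.  At every node q of
-- BT(M) (the root or an argument position) the term g q assigned to it is
-- head-reduced to its head normal form λx̄.(…(y)Q₁…)Qₙ, or, if unsolvable,
-- sent to ⊥ in one β⊥-step; along the left spine below q nothing more happens,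
-- and the arguments Qᵢ are again the terms assigned to the argument nodes.
-- Head reduction is β-reduction, so when BT(M) has no ⊥ the same derivation
-- is a β-derivation.  The left spines below the nodes are finite, which gives
-- the 001 condition on BT(M).

open import Defs
open import Data.Product using (_×_; Σ; _,_; proj₁; proj₂; uncurry)
open import Data.Nat using (zero; suc; pred)
open import Data.List using ([]; _∷_; _++_; [_]; _∷ʳ_; length; replicate)
open import Data.List.Properties using (++-assoc)
open import Data.List.Reverse using (Reverse; []; _∶_∶ʳ_; reverseView)
open import Data.Sum using (inj₁; inj₂)
open import Data.Unit using (tt)
open import Data.Empty using (⊥-elim)
open import Relation.Nullary using (Dec; yes; no; contradiction)
open import Relation.Nullary.Decidable using (map′; _×-dec_)
open import Relation.Binary.Core using (_⇒_)
open import Relation.Binary.PropositionalEquality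
  using (_≡_; refl; sym; trans; cong; cong-app; subst; subst₂)
open import Relation.Binary.Construct.Closure.ReflexiveTransitive as Star
  using (Star; ε; _◅_)

Ctx-map : ∀ {S S′ : Rel} → S ⇒ S′ → Ctx S ⇒ Ctx S′
Ctx-map f (root s)          = root (f s)
Ctx-map f (lamC e₁ e₂ r)    = lamC e₁ e₂ (Ctx-map f r)
Ctx-map f (appL e₁ e₂ r eq) = appL e₁ e₂ (Ctx-map f r) eq
Ctx-map f (appR e₁ e₂ eq r) = appR e₁ e₂ eq (Ctx-map f r)

head⇒β : Head ⇒ _→β_
head⇒β (hβ b)              = root b
head⇒β (hlam e₁ e₂ h)      = lamC e₁ e₂ (head⇒β h)
head⇒β (happ e₁ _ e₃ h eq) = appL e₁ e₃ (head⇒β h) eq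

β⇒β⊥ : _→β_ ⇒ _→β⊥_
β⇒β⊥ = Ctx-map beta

at-root : ∀ (U : Tree) p → at U p [] ≡ U p
at-root U []      = refl
at-root U (d ∷ p) = at-root (down d U) p

at-++ : ∀ (U : Tree) p q → at U (p ++ q) ≡ at (at U p) q
at-++ U []      q = refl
at-++ U (d ∷ p) q = at-++ (down d U) p q

valid-++⁻ : ∀ (U : Tree) p {q} → Valid U (p ++ q) → Valid U p × Valid (at U p) q
valid-++⁻ U []      v         = here , v
valid-++⁻ U (L ∷ p) (goL h v) with valid-++⁻ (down L U) p v
... | vp , vq = goL h vp , vq
valid-++⁻ U (R ∷ p) (goR e v) with valid-++⁻ (down R U) p v
... | vp , vq = goR e vp , vq

hasL? : ∀ l → Dec (HasL l)
hasL? (var _) = no λ ()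
hasL? lam     = yes tt
hasL? app     = yes tt
hasL? bot     = no λ ()

isApp? : ∀ l → Dec (l ≡ app)
isApp? (var _) = no λ ()
isApp? lam     = no λ ()
isApp? app     = yes refl
isApp? bot     = no λ ()

valid? : ∀ (U : Tree) p → Dec (Valid U p)
valid? U []      = yes here
valid? U (L ∷ p) = map′ (uncurry goL) (λ { (goL h v) → h , v })
                        (hasL? (U []) ×-dec valid? (down L U) p)
valid? U (R ∷ p) = map′ (uncurry goR) (λ { (goR e v) → e , v })
                        (isApp? (U []) ×-dec valid? (down R U) p)

data Spine (G : Pos → Tree) (X U : Tree) : Set where
  spine : X [] ≡ U [] →
          (HasL (U []) → Spine (λ r → G (L ∷ r)) (down L X) (down L U)) →
          (U [] ≡ app → down R X ≈ G [ R ]) →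
          Spine G X U

Spine-cong : ∀ {G G′ : Pos → Tree} {X U} → (∀ r → G r ≡ G′ r) → Spine G X U → Spine G′ X U
Spine-cong G≗G′ (spine lab left right) =
  spine lab
        (λ h → Spine-cong (λ r → G≗G′ (L ∷ r)) (left h))
        (λ e s w → trans (right e s w) (cong-app (G≗G′ [ R ]) s))

Spine-≈ : ∀ {G X U U′} → U ≈ U′ → Spine G X U′ → Spine G X U
Spine-≈ {U = U} {U′} U≈U′ (spine lab left right) =
  spine (trans lab (sym root≡))
        (λ h → Spine-≈ (λ s w → U≈U′ (L ∷ s) (goL h w)) (left (subst HasL root≡ h)))
        (λ e → right (trans (sym root≡) e))
  where
  root≡ : U [] ≡ U′ []
  root≡ = U≈U′ [] here

Spine⇒LeftFin : ∀ {G X U} → Spine G X U → LeftFin U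
Spine⇒LeftFin {U = U} (spine _ left _) with hasL? (U [])
... | yes h = step h (Spine⇒LeftFin (left h))
... | no ¬h = stop ¬h

ArgsAt-shift : ∀ (G : Pos → Tree) pre qs → ArgsAt G (L ∷ pre) qs → ArgsAt (λ r → G (L ∷ r)) pre qs
ArgsAt-shift G pre []       _       = tt
ArgsAt-shift G pre (q ∷ qs) (e , a) = e , ArgsAt-shift G (pre ++ [ L ]) qs a

ArgsAt-lefts : ∀ (G : Pos → Tree) m qs → ArgsAt G (replicate m L) qs →
               ArgsAt (λ r → G (replicate m L ++ r)) [] qs
ArgsAt-lefts G zero    qs a = a
ArgsAt-lefts G (suc m) qs a =
  ArgsAt-lefts (λ r → G (L ∷ r)) m qs (ArgsAt-shift G (replicate m L) qs a)

Spine-appsR : ∀ {G} y qs us → length us ≡ length qs → ArgsAt G [] qs →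
              Spine G (appsR (vT y) qs) (appsR (vT y) us)
Spine-appsR y []       []       _   _ = spine refl (λ ()) (λ ())
Spine-appsR {G} y (q ∷ qs) (u ∷ us) len (e , a) =
  spine refl
        (λ _ → Spine-appsR y qs us (cong pred len) (ArgsAt-shift G [] qs a))
        (λ _ s _ → sym (cong-app e s))

Spine-lams : ∀ {G X U} m → Spine (λ r → G (replicate m L ++ r)) X U → Spine G (lams m X) (lams m U)
Spine-lams zero    sp = sp
Spine-lams (suc m) sp = spine refl (λ _ → Spine-lams m sp) (λ ())

clauseHnf : ∀ {N U G} → BTClause N U G → Tree
clauseHnf (inj₁ _)                     = botT
clauseHnf (inj₂ (_ , m , y , qs , _)) = lams m (appsR (vT y) qs)

clause-Spine : ∀ {N U G} (c : BTClause N U G) → Spine G (clauseHnf c) U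
clause-Spine (inj₁ (_ , U⊥)) =
  spine (sym U⊥) (λ h → ⊥-elim (subst HasL U⊥ h)) (λ e → contradiction (trans (sym U⊥) e) λ ())
clause-Spine {G = G} (inj₂ (_ , m , y , qs , us , _ , U≈ , len , args)) =
  Spine-≈ U≈ (Spine-lams m (Spine-appsR y qs us len (ArgsAt-lefts G m qs args)))

clause-reduces : ∀ {S : Rel} {N U G} → Head ⇒ S → (Unsolvable N → U [] ≡ bot → Star S N botT) →
                 (c : BTClause N U G) → Star S N (clauseHnf c)
clause-reduces _      unsolvable↠⊥ (inj₁ (u , U⊥))                    = unsolvable↠⊥ u U⊥
clause-reduces head⇒S _            (inj₂ (_ , _ , _ , _ , _ , h↠ , _)) = Star.map head⇒S h↠

-- walk N st p is the pair (term placed at p, the term it is rewritten to) when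
-- st is this pair at the root and N r the pair at the argument node r ∷ʳ R;
-- below a node on its left spine no rewriting takes place.
walk : (Pos → Tree × Tree) → Tree × Tree → Pos → Tree × Tree
walk N st       []      = st
walk N (_ , X)  (L ∷ p) = walk (λ r → N (L ∷ r)) (down L X , down L X) p
walk N _        (R ∷ p) = walk (λ r → N (R ∷ r)) (N []) p

walk-∷ʳL : ∀ N st p → walk N st (p ∷ʳ L) ≡ (down L (proj₂ (walk N st p)) , down L (proj₂ (walk N st p)))
walk-∷ʳL N st       []      = refl
walk-∷ʳL N (_ , X)  (L ∷ p) = walk-∷ʳL (λ r → N (L ∷ r)) (down L X , down L X) p
walk-∷ʳL N _        (R ∷ p) = walk-∷ʳL (λ r → N (R ∷ r)) (N []) p

walk-∷ʳR : ∀ N st p → walk N st (p ∷ʳ R) ≡ N p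
walk-∷ʳR N st       []      = refl
walk-∷ʳR N (_ , X)  (L ∷ p) = walk-∷ʳR (λ r → N (L ∷ r)) (down L X , down L X) p
walk-∷ʳR N _        (R ∷ p) = walk-∷ʳR (λ r → N (R ∷ r)) (N []) p

module BöhmDerivation {M T : Tree} (bt : IsBT M T) where
  open IsBT bt

  hnfAt : ∀ q → IsNode q → Tree
  hnfAt q n with valid? T q
  ... | yes v = clauseHnf (node q v n)
  ... | no _  = g q

  stage : Pos → Tree × Tree
  stage = walk (λ r → g (r ∷ʳ R) , hnfAt (r ∷ʳ R) (argN r)) (g [] , hnfAt [] rootN)

  termAt reductAt : Pos → Tree
  termAt   p = proj₁ (stage p)
  reductAt p = proj₂ (stage p)

  termAt-∷ʳL : ∀ p → termAt (p ∷ʳ L) ≡ down L (reductAt p)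
  termAt-∷ʳL p = cong proj₁ (walk-∷ʳL _ _ p)

  termAt-∷ʳR : ∀ p → termAt (p ∷ʳ R) ≡ g (p ∷ʳ R)
  termAt-∷ʳR p = cong proj₁ (walk-∷ʳR _ _ p)

  reductAt-∷ʳL : ∀ p → reductAt (p ∷ʳ L) ≡ down L (reductAt p)
  reductAt-∷ʳL p = cong proj₂ (walk-∷ʳL _ _ p)

  reductAt-∷ʳR : ∀ p → reductAt (p ∷ʳ R) ≡ hnfAt (p ∷ʳ R) (argN p)
  reductAt-∷ʳR p = cong proj₂ (walk-∷ʳR _ _ p)

  node-Spine : ∀ {q} (n : IsNode q) → Valid T q → Spine (λ r → g (q ++ r)) (hnfAt q n) (at T q)
  node-Spine {q} n v with valid? T q
  ... | yes v′ = clause-Spine (node q v′ n)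
  ... | no ¬v  = contradiction v ¬v

  reductAt-Spine : ∀ {p} → Reverse p → Valid T p → Spine (λ r → g (p ++ r)) (reductAt p) (at T p)
  reductAt-Spine []            v = node-Spine rootN v
  reductAt-Spine (p ∶ _ ∶ʳ R)  v =
    subst (λ X → Spine _ X _) (sym (reductAt-∷ʳR p)) (node-Spine (argN p) v)
  reductAt-Spine (p ∶ rp ∶ʳ L) v with valid-++⁻ T p v
  ... | vp , goL h _ with reductAt-Spine rp vp
  ...   | spine _ left _ =
    subst₂ (Spine _) (sym (reductAt-∷ʳL p)) (sym (at-++ T p [ L ]))
           (Spine-cong (λ r → cong g (sym (++-assoc p [ L ] r))) (left h))

  module _ {S : Rel} (head⇒S : Head ⇒ S)
           (unsolvable↠⊥ : ∀ {q} → Valid T q → T q ≡ bot → Unsolvable (g q) → Star S (g q) botT) where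

    node-reduces : ∀ {q} (n : IsNode q) → Valid T q → Star S (g q) (hnfAt q n)
    node-reduces {q} n v with valid? T q
    ... | yes v′ = clause-reduces head⇒S (λ u U⊥ → unsolvable↠⊥ v (trans (sym (at-root T q)) U⊥) u)
                                 (node q v′ n)
    ... | no ¬v  = contradiction v ¬v

    termAt-reduces : ∀ p → Valid T p → Star S (termAt p) (reductAt p)
    termAt-reduces p v with reverseView p
    ... | []          = node-reduces rootN v
    ... | q ∶ _ ∶ʳ R  = subst (uncurry (Star S)) (sym (walk-∷ʳR _ _ q)) (node-reduces (argN q) v)
    ... | q ∶ _ ∶ʳ L  = subst (uncurry (Star S)) (sym (walk-∷ʳL _ _ q)) ε

    derivation : Inf S M T
    derivation = record
      { target001 = λ p v → Spine⇒LeftFin (reductAt-Spine (reverseView p) v)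
      ; res       = termAt
      ; resRoot   = gRoot
      ; resStep   = resStep
      }
      where
      resStep : ∀ p → Valid T p → Σ Tree λ X →
                Star S (termAt p) X × X [] ≡ T p ×
                (HasL (T p) → down L X ≈ termAt (p ++ [ L ])) ×
                (T p ≡ app → down R X ≈ termAt (p ++ [ R ]))
      resStep p v with reductAt-Spine (reverseView p) v
      ... | spine lab _ right =
        reductAt p , termAt-reduces p v , trans lab (at-root T p) ,
        (λ _ s _ → cong-app (sym (termAt-∷ʳL p)) s) ,
        (λ e s w → trans (right (trans (at-root T p) e) s w) (cong-app (sym (termAt-∷ʳR p)) s))

-- M ∈ Λ^{001}_∞ only guarantees that BT(M) exists; IsBT M T already carries
-- all the data the derivation is built from.
lemma5p16 : (M : Tree) → Is001 M → NoBot M → (T : Tree) → IsBT M T →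
              (M →β⊥∞ T) × (NoBot T → M →β∞ T)
lemma5p16 M _ _ T bt =
    derivation (λ h → β⇒β⊥ (head⇒β h)) (λ _ _ u → root (unsol u refl) ◅ ε)
  , λ noBot → derivation head⇒β (λ v T⊥ _ → contradiction T⊥ (noBot _ v))
  where open BöhmDerivation bt
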